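{- Let $\langle B_1,S_1\rangle$ and $\langle B_2,S_2\rangle$ be Induction Models. Then $\langle B_1,S_1\rangle$ can be reduced to $\langle B_2,S_2\rangle$ if and only if $n(\langle B_1,S_1\rangle)\le n(\langle B_2,S_2\rangle)$. Moreover, $\langle B_1,S_1\rangle$ and $\langle B_2,S_2\rangle$ are equivalent if and only if $n(\langle B_1,S_1\rangle)=n(\langle B_2,S_2\rangle)$.
   Context: $\mathbb{N}=\{1,2,\dots\}$. An Induction Model (I.M.) is a pair $\langle B,S\rangle$ with $B\subset\mathbb{N}$ and $S:\mathbb{N}^k\to\mathbb{Z}$ for some $k\ge1$. For $A\subseteq\mathbb{N}$ write $S(A)=\{S(x_1,\dots,x_k): x_1,\dots,x_k\in A\}\cap\mathbb{N}$ (entries need not be distinct). Powers: $S^0(B)=B$ and $S^i(B)=\{S(x_1,\dots,x_k): x_1,\dots,x_k\in\bigcup_{j=0}^{i-1}S^j(B)\}\cap\mathbb{N}$ for $i\ge1$. Closures: $Cl_n(\langle B,S\rangle)=\bigcup_{i=0}^n S^i(B)$ and $Cl(\langle B,S\rangle)=\bigcup_{i=0}^\infty S^i(B)$. Difference sets: $D_n(\langle B,S\rangle)=S^n(B)\setminus Cl_{n-1}(\langle B,S\rangle)$ for $n\ge1$. Number of steps: $n(\langle B,S\rangle)=\min\{i\ge1: D_i(\langle B,S\rangle)=\emptyset\}$, and $n(\langle B,S\rangle)=\aleph_0$ if no such $i$ exists (every natural number is $<\aleph_0$). For $x\in Cl(\langle B,S\rangle)$ let $l(x,\langle B,S\rangle)=\min\{i\ge0: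 x\in S^i(B)\}$. An injective version $S_{inj}$ of $S$ is obtained by choosing, for every $x\in Cl(\langle B,S\rangle)\setminus B$, a tuple $\mathbf{n}_x$ with all entries in $Cl_{l(x,\langle B,S\rangle)-1}(\langle B,S\rangle)$ and $S(\mathbf{n}_x)=x$, and setting $S_{inj}(\mathbf{n})=S(\mathbf{n})$ if $\mathbf{n}=\mathbf{n}_x$ for some such $x$, and $S_{inj}(\mathbf{n})=0$ otherwise. Reduction: with $S_1$ $k_1$-ary and $S_2$ $k_2$-ary, $\langle B_1,S_1\rangle$ can be reduced to $\langle B_2,S_2\rangle$ if, for an injective version $S_{2,inj}$ of $S_2$, there is a map $R:Cl(\langle B_2,S_2\rangle)\to 2^{Cl(\langle B_1,S_1\rangle)}$ such that (1) $\bigcup_{x\in Cl(\langle B_2,S_2\rangle)}R(x)=Cl(\langle B_1,S_1\rangle)$; (2) $\bigcup_{x\in B_2}R(x)=B_1$; (3) for every $x\in Cl(\langle B_2,S_2\rangle)\setminus B_2$, writing $x=S_{2,inj}(n_1,\dots,n_{k_2})$ with $(n_1,\dots,n_{k_2})$ the chosen tuple $\mathbf{n}_x$, we have $R(x)=S_1\big(\bigcup_{i=1}^{k_2}R(n_i)\big)\cup\bigcup_{i=1}^{k_2}R(n_i)$. Two I.M.s are equivalent if each can be reduced to the other. -}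

module Defs where

open import Level using (0ℓ)
open import Data.Nat using (ℕ; zero; suc; _≤_; _<_; _∸_)
open import Data.Integer using (ℤ; +_)
open import Data.Fin using (Fin)
open import Data.Product using (Σ; ∃; _×_; _,_)
open import Data.Sum using (_⊎_)
open import Data.Empty using (⊥)
open import Relation.Nullary using (¬_)
open import Relation.Binary.PropositionalEquality using (_≡_)
open import Function.Bundles using (_⇔_)

-- The paper's ℕ = {1,2,...} is modelled by Agda's ℕ restricted to values ≥ 1:
-- the base set is required to consist of positive numbers, and S(A) keeps
-- only the positive values of S ("∩ ℕ").

Subset : Set₁
Subset = ℕ → Set

record IM : Set₁ where
  field
    B      : Subset
    B-pos  : ∀ x → B x → 1 ≤ x
    k      : ℕ
    k≥1    : 1 ≤ k
    S      : (Fin k → ℕ) → ℤ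

Img : {k : ℕ} → ((Fin k → ℕ) → ℤ) → Subset → Subset
Img {k} S A x = Σ (Fin k → ℕ) λ t → (∀ i → A (t i)) × (S t ≡ + x) × (1 ≤ x)

module _ (M : IM) where
  open IM M

  mutual
    Pow : ℕ → Subset
    Pow zero    = B
    Pow (suc i) = Img S (Cl i)

    Cl : ℕ → Subset
    Cl zero    x = Pow zero x
    Cl (suc n) x = Cl n x ⊎ Pow (suc n) x

  ClAll : Subset
  ClAll x = ∃ λ i → Pow i x

  D : ℕ → Subset
  D n x = Pow n x × ¬ Cl (n ∸ 1) x

  DEmpty : ℕ → Set
  DEmpty n = ∀ x → ¬ D n x

  IsLevel : ℕ → ℕ → Set
  IsLevel x l = Pow l x × (∀ j → j < l → ¬ Pow j x)

data ℕ∞ : Set where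
  fin : ℕ → ℕ∞
  ℵ₀  : ℕ∞

data _≤∞_ : ℕ∞ → ℕ∞ → Set where
  fin≤fin : ∀ {m n} → m ≤ n → fin m ≤∞ fin n
  ≤ℵ₀     : ∀ {a} → a ≤∞ ℵ₀

-- NSteps M v  :  n(M) = v, i.e. v = min{ i ≥ 1 : D_i = ∅ }, or ℵ₀ if no such i.
NSteps : IM → ℕ∞ → Set
NSteps M (fin i) = (1 ≤ i) × DEmpty M i × (∀ j → 1 ≤ j → j < i → ¬ DEmpty M j)
NSteps M ℵ₀      = ∀ i → 1 ≤ i → ¬ DEmpty M i

-- An injective version of S, given by the chosen tuples n_x for x ∈ Cl ∖ B
-- (S_inj(n) = S(n) if n = n_x, and 0 otherwise; only the n_x are used below).
record InjVersion (M : IM) : Set where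
  open IM M
  field
    tup     : ℕ → (Fin k → ℕ)
    tup-val : ∀ x → ClAll M x → ¬ B x → S (tup x) ≡ + x
    tup-lev : ∀ x → ClAll M x → ¬ B x → ∀ l → IsLevel M x l →
              ∀ i → Cl M (l ∸ 1) (tup x i)

Reducible : IM → IM → Set₁
Reducible M₁ M₂ =
  Σ (InjVersion M₂) λ inj → Σ (ℕ → Subset) λ R →
    let open InjVersion inj
        U : ℕ → Subset
        U x y = ∃ λ i → R (tup x i) y
    in
    (∀ x → ClAll M₂ x → ∀ y → R x y → ClAll M₁ y)
    × (∀ y → ClAll M₁ y → ∃ λ x → ClAll M₂ x × R x y)
    × (∀ y → (∃ λ x → IM.B M₂ x × R x y) ⇔ IM.B M₁ y)
    × (∀ x → ClAll M₂ x → ¬ IM.B M₂ x →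
         ∀ y → R x y ⇔ (Img (IM.S M₁) (U x) y ⊎ U x y))

Equivalent : IM → IM → Set₁
Equivalent M₁ M₂ = Reducible M₁ M₂ × Reducible M₂ M₁

NonemptyBase : IM → Set
NonemptyBase M = ∃ λ x → IM.B M x

module Submission where

open import Defs
open import Level using (0ℓ)
open import Axiom.ExcludedMiddle using (ExcludedMiddle)
open import Data.Product using (_×_; Σ; ∃; _,_; proj₁; proj₂)
open import Relation.Binary.PropositionalEquality using (_≡_; refl; cong; subst)
open import Function.Bundles using (_⇔_; mk⇔; Equivalence)
open import Function.Construct.Composition using (_⇔-∘_)
open import Data.Nat using (ℕ; zero; suc; _≤_; z≤n; s≤s; _∸_)
open import Data.Nat.Properties
  using (≤-refl; ≤-trans; ≤-antisym; ≤-pred; n≤1+n; <-cmp; ≰⇒>; _≤?_; ∸-monoˡ-≤; m≤n⇒m<n∨m≡n)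
open import Data.Fin using (Fin; fromℕ<)
open import Data.Integer using (ℤ; +_)
open import Data.Sum using (_⊎_; inj₁; inj₂)
import Data.Sum as Sum
open import Data.Empty using (⊥-elim)
open import Relation.Nullary using (¬_; Dec; yes; no)
open import Relation.Binary.Definitions using (tri<; tri≈; tri>)

-- The reduction witnessing n(M₁) ≤ n(M₂) sends an element of level l of M₂ to
-- Cl_l(M₁): a generating tuple of an element of level l+1 has an entry of level
-- l, so condition (3) becomes Cl_{l+1} = S(Cl_l) ∪ Cl_l. Conversely any
-- reduction maps Cl_n(M₂) into Cl_n(M₁), so once M₂ stops growing so does M₁.

_⊆_ : Subset → Subset → Set
A ⊆ A′ = ∀ x → A x → A′ x

Img-mono : ∀ {k} (S : (Fin k → ℕ) → ℤ) {A A′ : Subset} → A ⊆ A′ → Img S A ⊆ Img S A′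
Img-mono S A⊆A′ x (t , t∈A , St≡x , x≥1) = t , (λ i → A⊆A′ _ (t∈A i)) , St≡x , x≥1

≤∞-refl : ∀ a → a ≤∞ a
≤∞-refl (fin n) = fin≤fin ≤-refl
≤∞-refl ℵ₀      = ≤ℵ₀

≤∞-trans : ∀ {a b c} → a ≤∞ b → b ≤∞ c → a ≤∞ c
≤∞-trans (fin≤fin a≤b) (fin≤fin b≤c) = fin≤fin (≤-trans a≤b b≤c)
≤∞-trans _             ≤ℵ₀           = ≤ℵ₀

≤∞-antisym : ∀ {a b} → a ≤∞ b → b ≤∞ a → a ≡ b
≤∞-antisym (fin≤fin a≤b) (fin≤fin b≤a) = cong fin (≤-antisym a≤b b≤a)
≤∞-antisym {ℵ₀} {ℵ₀} ≤ℵ₀ ≤ℵ₀           = refl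

module Closure (M : IM) where
  open IM M

  Pow⊆Cl : ∀ n → Pow M n ⊆ Cl M n
  Pow⊆Cl zero    x p = p
  Pow⊆Cl (suc n) x p = inj₂ p

  Cl-mono : ∀ {m n} → m ≤ n → Cl M m ⊆ Cl M n
  Cl-mono {zero}  {zero}  _         x p        = p
  Cl-mono {zero}  {suc n} _         x p        = inj₁ (Cl-mono {zero} {n} z≤n x p)
  Cl-mono {suc m} {suc n} (s≤s m≤n) x (inj₁ p) = inj₁ (Cl-mono m≤n x p)
  Cl-mono {suc m} {suc n} (s≤s m≤n) x (inj₂ p) = inj₂ (Img-mono S (Cl-mono m≤n) x p)

  Pow⊆Cl-≤ : ∀ {j n} → j ≤ n → Pow M j ⊆ Cl M n
  Pow⊆Cl-≤ {j} j≤n x p = Cl-mono j≤n x (Pow⊆Cl j x p)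

  Cl⊆ClAll : ∀ n → Cl M n ⊆ ClAll M
  Cl⊆ClAll zero    x p        = 0 , p
  Cl⊆ClAll (suc n) x (inj₁ p) = Cl⊆ClAll n x p
  Cl⊆ClAll (suc n) x (inj₂ p) = suc n , p

  Cl-suc : ∀ {n} {A : Subset} → (∀ y → A y ⇔ Cl M n y) →
           ∀ y → Cl M (suc n) y ⇔ (Img S A y ⊎ A y)
  Cl-suc {n} {A} A⇔Cl y = mk⇔ to from
    where
    A⊆Cl : A ⊆ Cl M n
    A⊆Cl z = Equivalence.to (A⇔Cl z)
    Cl⊆A : Cl M n ⊆ A
    Cl⊆A z = Equivalence.from (A⇔Cl z)
    to : Cl M (suc n) y → Img S A y ⊎ A y
    to (inj₁ c) = inj₂ (Cl⊆A y c)
    to (inj₂ p) = inj₁ (Img-mono S Cl⊆A y p)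
    from : Img S A y ⊎ A y → Cl M (suc n) y
    from (inj₁ p) = inj₂ (Img-mono S A⊆Cl y p)
    from (inj₂ a) = inj₁ (A⊆Cl y a)

module Levels (em : ExcludedMiddle 0ℓ) (M : IM) where
  open IM M
  open Closure M

  level-new : ∀ {n x} → Pow M (suc n) x → ¬ Cl M n x → IsLevel M x (suc n)
  level-new p x∉Cl = p , λ { j (s≤s j≤n) pj → x∉Cl (Pow⊆Cl-≤ j≤n _ pj) }

  level-exists : ∀ n x → Cl M n x → ∃ λ l → l ≤ n × IsLevel M x l
  level-exists zero    x p        = 0 , z≤n , p , λ j ()
  level-exists (suc n) x (inj₁ c) with level-exists n x c
  ... | l , l≤n , lv = l , ≤-trans l≤n (n≤1+n n) , lv
  level-exists (suc n) x (inj₂ p) with em {Cl M n x}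
  ... | yes c with level-exists n x c
  ...   | l , l≤n , lv = l , ≤-trans l≤n (n≤1+n n) , lv
  level-exists (suc n) x (inj₂ p) | no x∉Cl = suc n , ≤-refl , level-new p x∉Cl

  level-unique : ∀ {x l l′} → IsLevel M x l → IsLevel M x l′ → l ≡ l′
  level-unique {l = l} {l′} lv lv′ with <-cmp l l′
  ... | tri< l<l′ _ _ = ⊥-elim (proj₂ lv′ l l<l′ (proj₁ lv))
  ... | tri≈ _ l≡l′ _ = l≡l′
  ... | tri> _ _ l′<l = ⊥-elim (proj₂ lv l′ l′<l (proj₁ lv′))

  level-≤ : ∀ {n x l} → Cl M n x → IsLevel M x l → l ≤ n
  level-≤ {n} {x} c lv with level-exists n x c
  ... | l₀ , l₀≤n , lv₀ = subst (_≤ n) (level-unique lv₀ lv) l₀≤n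

  Cl-pred : ∀ {n x} → Cl M (suc n) x → ¬ IsLevel M x (suc n) → Cl M n x
  Cl-pred {n} {x} c ¬lv with level-exists (suc n) x c
  ... | l , l≤1+n , lv with m≤n⇒m<n∨m≡n l≤1+n
  ...   | inj₁ l<1+n = Pow⊆Cl-≤ (≤-pred l<1+n) x (proj₁ lv)
  ...   | inj₂ refl  = ⊥-elim (¬lv lv)

  ClAll⊆Cl : ∀ m → DEmpty M (suc m) → ClAll M ⊆ Cl M m
  ClAll⊆Cl m D-empty x (i , p) = Cl-stable i x (Pow⊆Cl i x p)
    where
    Pow-suc⊆Cl : Pow M (suc m) ⊆ Cl M m
    Pow-suc⊆Cl y q with em {Cl M m y}
    ... | yes c    = c
    ... | no y∉Cl = ⊥-elim (D-empty y (q , y∉Cl))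
    Cl-stable : ∀ i → Cl M i ⊆ Cl M m
    Cl-stable zero    y q        = Cl-mono {0} {m} z≤n y q
    Cl-stable (suc i) y (inj₁ q) = Cl-stable i y q
    Cl-stable (suc i) y (inj₂ q) = Pow-suc⊆Cl y (Img-mono S (Cl-stable i) y q)

  D-nonempty-level : ∀ m → ¬ DEmpty M (suc m) → ∃ λ x → IsLevel M x (suc m)
  D-nonempty-level m D-nonempty with em {∃ λ x → D M (suc m) x}
  ... | yes (x , p , x∉Cl) = x , level-new p x∉Cl
  ... | no no-x            = ⊥-elim (D-nonempty λ x d → no-x (x , d))

  -- Otherwise all entries lie in Cl_{l-1}, putting x in S^l(B).
  generator-entry-level : ∀ {x l} (t : Fin k → ℕ) → S t ≡ + x → (∀ i → Cl M l (t i)) →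
                          IsLevel M x (suc l) → ∃ λ i → IsLevel M (t i) l
  generator-entry-level {x} {zero}  t _ t∈Cl _ = fromℕ< k≥1 , t∈Cl (fromℕ< k≥1) , λ j ()
  generator-entry-level {x} {suc l} t St≡x t∈Cl lv with em {∃ λ i → IsLevel M (t i) (suc l)}
  ... | yes e   = e
  ... | no none = ⊥-elim (proj₂ lv (suc l) ≤-refl (t , t∈Cl-pred , St≡x , x≥1))
    where
    t∈Cl-pred : ∀ i → Cl M l (t i)
    t∈Cl-pred i = Cl-pred (t∈Cl i) λ lvi → none (i , lvi)
    x≥1 : 1 ≤ x
    x≥1 = proj₂ (proj₂ (proj₂ (proj₁ lv)))

  Generates : ℕ → (Fin k → ℕ) → Set
  Generates x t = (S t ≡ + x) × (∀ l → IsLevel M x l → ∀ i → Cl M (l ∸ 1) (t i))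

  generator : ∀ x → ClAll M x → ¬ B x → Σ (Fin k → ℕ) (Generates x)
  generator x (i , p) x∉B with level-exists i x (Pow⊆Cl i x p)
  ... | zero  , _ , (x∈B , _) = ⊥-elim (x∉B x∈B)
  ... | suc l , _ , lv@((t , t∈Cl , St≡x , _) , _) =
    t , St≡x , λ l′ lv′ i → subst (λ m → Cl M (m ∸ 1) (t i)) (level-unique lv lv′) (t∈Cl i)

  -- Excluded middle makes the choice of n_x definable; the tuple outside Cl ∖ B is junk.
  choose : ∀ x → Dec (Σ (Fin k → ℕ) (Generates x)) → Fin k → ℕ
  choose x (yes (t , _)) = t
  choose x (no _)        = λ _ → 0

  choose-generates : ∀ x (d : Dec (Σ (Fin k → ℕ) (Generates x))) →
                     Σ (Fin k → ℕ) (Generates x) → Generates x (choose x d)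
  choose-generates x (yes (_ , g)) _ = g
  choose-generates x (no none)     e = ⊥-elim (none e)

  injVersion : InjVersion M
  injVersion = record
    { tup     = λ x → choose x em
    ; tup-val = λ x c x∉B → proj₁ (choose-generates x em (generator x c x∉B))
    ; tup-lev = λ x c x∉B → proj₂ (choose-generates x em (generator x c x∉B))
    }

module Steps (em : ExcludedMiddle 0ℓ) (M : IM) where
  open Closure M
  open Levels em M

  NSteps-minimal : ∀ {a m} → NSteps M a → DEmpty M (suc m) → a ≤∞ fin (suc m)
  NSteps-minimal {ℵ₀}    {m} never-empty D-empty = ⊥-elim (never-empty (suc m) (s≤s z≤n) D-empty)
  NSteps-minimal {fin a} {m} (_ , _ , earlier-nonempty) D-empty with a ≤? suc m
  ... | yes a≤1+m = fin≤fin a≤1+m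
  ... | no  a≰1+m = ⊥-elim (earlier-nonempty (suc m) (s≤s z≤n) (≰⇒> a≰1+m) D-empty)

  ClAll-within-steps : ∀ {a y} → NSteps M a → ClAll M y → ∃ λ m → fin (suc m) ≤∞ a × Cl M m y
  ClAll-within-steps {fin zero}    (() , _)
  ClAll-within-steps {fin (suc a)} (_ , D-empty , _) c = a , ≤∞-refl _ , ClAll⊆Cl a D-empty _ c
  ClAll-within-steps {ℵ₀}          _ (i , p) = i , ≤ℵ₀ , Pow⊆Cl i _ p

  level-inhabited : ∀ {b m} → NSteps M b → NonemptyBase M → fin (suc m) ≤∞ b →
                    ∃ λ x → IsLevel M x m
  level-inhabited {m = zero}  _ (x , x∈B) _ = x , x∈B , λ j ()
  level-inhabited {ℵ₀}    {suc m} never-empty _ _ = D-nonempty-level m (never-empty (suc m) (s≤s z≤n))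
  level-inhabited {fin b} {suc m} (_ , _ , earlier-nonempty) _ (fin≤fin m<b) =
    D-nonempty-level m (earlier-nonempty (suc m) (s≤s z≤n) m<b)

module LevelReduction (em : ExcludedMiddle 0ℓ) (M₁ M₂ : IM) where
  module C₁ = Closure M₁
  module C₂ = Closure M₂
  module L₂ = Levels em M₂

  inj : InjVersion M₂
  inj = L₂.injVersion

  open InjVersion inj

  R : ℕ → Subset
  R x y = ∃ λ l → IsLevel M₂ x l × Cl M₁ l y

  U : ℕ → Subset
  U x y = ∃ λ i → R (tup x i) y

  R-at-level : ∀ {x l} → IsLevel M₂ x l → ∀ y → R x y ⇔ Cl M₁ l y
  R-at-level lv y = mk⇔
    (λ (_ , lv′ , c) → subst (λ m → Cl M₁ m y) (L₂.level-unique lv′ lv) c)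
    (λ c → _ , lv , c)

  R⊆ClAll : ∀ x → ClAll M₂ x → ∀ y → R x y → ClAll M₁ y
  R⊆ClAll _ _ y (l , _ , c) = C₁.Cl⊆ClAll l y c

  R-base : NonemptyBase M₂ → ∀ y → (∃ λ x → IM.B M₂ x × R x y) ⇔ IM.B M₁ y
  R-base (x₀ , x₀∈B) y = mk⇔
    (λ (_ , x∈B , r) → Equivalence.to (R-at-level (x∈B , λ j ()) y) r)
    (λ y∈B → x₀ , x₀∈B , 0 , (x₀∈B , λ j ()) , y∈B)

  U-at-level : ∀ {x l} → ClAll M₂ x → ¬ IM.B M₂ x → IsLevel M₂ x (suc l) →
               ∀ y → U x y ⇔ Cl M₁ l y
  U-at-level {x} {l} x∈Cl x∉B lv y = mk⇔
    (λ (i , l′ , lv′ , c) → C₁.Cl-mono {l′} {l} (L₂.level-≤ (entries i) lv′) y c)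
    (λ c → let (i , lvi) = L₂.generator-entry-level (tup x) (tup-val x x∈Cl x∉B) entries lv
           in i , Equivalence.from (R-at-level lvi y) c)
    where
    entries : ∀ i → Cl M₂ l (tup x i)
    entries = tup-lev x x∈Cl x∉B (suc l) lv

  R-step : ∀ x → ClAll M₂ x → ¬ IM.B M₂ x → ∀ y → R x y ⇔ (Img (IM.S M₁) (U x) y ⊎ U x y)
  R-step x x∈Cl@(i , p) x∉B y with L₂.level-exists i x (C₂.Pow⊆Cl i x p)
  ... | zero  , _ , (x∈B , _) = ⊥-elim (x∉B x∈B)
  ... | suc l , _ , lv        = C₁.Cl-suc {l} (U-at-level x∈Cl x∉B lv) y ⇔-∘ R-at-level lv y

  R-covers : ∀ {a b} → NSteps M₁ a → NSteps M₂ b → NonemptyBase M₂ → a ≤∞ b →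
             ∀ y → ClAll M₁ y → ∃ λ x → ClAll M₂ x × R x y
  R-covers na nb ne a≤b y y∈Cl with Steps.ClAll-within-steps em M₁ na y∈Cl
  ... | m , m<a , y∈Clₘ with Steps.level-inhabited em M₂ nb ne (≤∞-trans m<a a≤b)
  ...   | x , lv = x , (m , proj₁ lv) , m , lv , y∈Clₘ

≤⇒reducible : ExcludedMiddle 0ℓ → ∀ {M₁ M₂ a b} → NSteps M₁ a → NSteps M₂ b →
              NonemptyBase M₂ → a ≤∞ b → Reducible M₁ M₂
≤⇒reducible em {M₁} {M₂} na nb ne a≤b =
  inj , R , R⊆ClAll , R-covers na nb ne a≤b , R-base ne , R-step
  where open LevelReduction em M₁ M₂

module ReductionBound (em : ExcludedMiddle 0ℓ) {M₁ M₂ : IM}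
  (inj : InjVersion M₂) (R : ℕ → Subset)
  (R-base : ∀ y → (∃ λ x → IM.B M₂ x × R x y) ⇔ IM.B M₁ y)
  (R-step : ∀ x → ClAll M₂ x → ¬ IM.B M₂ x → ∀ y →
            R x y ⇔ (Img (IM.S M₁) (λ z → ∃ λ i → R (InjVersion.tup inj x i) z) y
                     ⊎ (∃ λ i → R (InjVersion.tup inj x i) y)))
  where
  open InjVersion inj
  module C₁ = Closure M₁
  module C₂ = Closure M₂
  module L₂ = Levels em M₂

  R⊆Cl : ∀ n x → Cl M₂ n x → R x ⊆ Cl M₁ n
  R⊆Cl zero    x x∈B      y r = Equivalence.to (R-base y) (x , x∈B , r)
  R⊆Cl (suc n) x (inj₁ c) y r = inj₁ (R⊆Cl n x c y r)
  R⊆Cl (suc n) x (inj₂ p) y r with em {IM.B M₂ x}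
  ... | yes x∈B = C₁.Cl-mono {0} {suc n} z≤n y (Equivalence.to (R-base y) (x , x∈B , r))
  ... | no x∉B with L₂.level-exists (suc n) x (inj₂ p)
  ...   | l , l≤1+n , lv =
    Sum.swap (Sum.map (Img-mono (IM.S M₁) entries⊆Cl y) (entries⊆Cl y)
                      (Equivalence.to (R-step x (suc n , p) x∉B y) r))
    where
    entries⊆Cl : (λ z → ∃ λ i → R (tup x i) z) ⊆ Cl M₁ n
    entries⊆Cl z (i , r′) =
      R⊆Cl n (tup x i) (C₂.Cl-mono (∸-monoˡ-≤ 1 l≤1+n) _ (tup-lev x (suc n , p) x∉B l lv i)) z r′

reducible⇒DEmpty : ExcludedMiddle 0ℓ → ∀ {M₁ M₂} → Reducible M₁ M₂ →
                   ∀ m → DEmpty M₂ (suc m) → DEmpty M₁ (suc m)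
reducible⇒DEmpty em {M₂ = M₂} (inj , R , _ , R-covers , R-base , R-step) m D₂-empty y (p , y∉Cl)
  with R-covers y (suc m , p)
... | x , x∈Cl , r =
  y∉Cl (ReductionBound.R⊆Cl em inj R R-base R-step m x (Levels.ClAll⊆Cl em M₂ m D₂-empty x x∈Cl) y r)

reducible⇒≤ : ExcludedMiddle 0ℓ → ∀ {M₁ M₂ a b} → NSteps M₁ a → NSteps M₂ b →
              Reducible M₁ M₂ → a ≤∞ b
reducible⇒≤ em {b = ℵ₀}          _  _                 _   = ≤ℵ₀
reducible⇒≤ em {b = fin zero}    _  (() , _)
reducible⇒≤ em {M₁} {b = fin (suc b)} na (_ , D₂-empty , _) red =
  Steps.NSteps-minimal em M₁ na (reducible⇒DEmpty em red b D₂-empty)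

theorem2 : ExcludedMiddle 0ℓ → (M₁ M₂ : IM) →
    NonemptyBase M₁ → NonemptyBase M₂ →
    ∀ (a b : ℕ∞) → NSteps M₁ a → NSteps M₂ b →
    (Reducible M₁ M₂ ⇔ (a ≤∞ b)) × (Equivalent M₁ M₂ ⇔ (a ≡ b))
theorem2 em M₁ M₂ ne₁ ne₂ a b na nb =
  mk⇔ (reducible⇒≤ em na nb) (≤⇒reducible em na nb ne₂) ,
  mk⇔ (λ (r₁₂ , r₂₁) → ≤∞-antisym (reducible⇒≤ em na nb r₁₂) (reducible⇒≤ em nb na r₂₁))
      (λ { refl → ≤⇒reducible em na nb ne₂ (≤∞-refl a) , ≤⇒reducible em nb na ne₁ (≤∞-refl a) })
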